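{- Let $\Gamma$ be a finite undirected multigraph (self-loops and parallel edges allowed) with vertex set $V$ and edge set $E$, and fix a vertex $v\in V$. Assume that $E\neq\varnothing$. Then \[ \sum_{\substack{F\subseteq E\text{ is pandemic}}}(-1)^{|F|}=0 . \]
   Context: For $F\subseteq E$, an $F$-path is a path of $\Gamma$ all of whose edges belong to $F$ (an edgeless path from a vertex to itself is allowed). For an edge $e\in E$ and $F\subseteq E$, we say $F$ infects $e$ if there exists an $F$-path from $v$ to some endpoint of $e$. A subset $F\subseteq E$ is pandemic if it infects every edge $e\in E$. -}

module Defs where

open import Data.Nat using (ℕ; zero; suc)
open import Data.Fin using (Fin)
open import Data.Fin.Subset using (Subset; _∈_; inside; outside; ∣_∣)
open import Data.Vec using (_∷_; [])
open import Data.Product using (_×_; _,_; proj₁; proj₂; ∃)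
open import Data.Sum using (_⊎_)
open import Data.Integer using (ℤ; _+_; -_; _^_; 0ℤ; 1ℤ)
open import Relation.Nullary using (Dec; yes; no)

-- A finite undirected multigraph: vertices Fin n, edges Fin m,
-- each edge has an (unordered) pair of endpoints; loops / parallel edges allowed.
record Multigraph : Set where
  field
    nV  : ℕ
    nE  : ℕ
    ends : Fin nE → Fin nV × Fin nV

open Multigraph public

Joins : (Γ : Multigraph) → Fin (nE Γ) → Fin (nV Γ) → Fin (nV Γ) → Set
Joins Γ e x y = ends Γ e ≡ (x , y) ⊎ ends Γ e ≡ (y , x)
  where open import Relation.Binary.PropositionalEquality using (_≡_)

data FPath (Γ : Multigraph) (F : Subset (nE Γ)) (x : Fin (nV Γ)) : Fin (nV Γ) → Set where
  here : FPath Γ F x x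
  step : ∀ {y z} (e : Fin (nE Γ)) → FPath Γ F x y → e ∈ F → Joins Γ e y z → FPath Γ F x z

Infects : (Γ : Multigraph) (v : Fin (nV Γ)) (F : Subset (nE Γ)) (e : Fin (nE Γ)) → Set
Infects Γ v F e = FPath Γ F v (proj₁ (ends Γ e)) ⊎ FPath Γ F v (proj₂ (ends Γ e))

Pandemic : (Γ : Multigraph) (v : Fin (nV Γ)) (F : Subset (nE Γ)) → Set
Pandemic Γ v F = ∀ e → Infects Γ v F e

sumSubsets : ∀ {m} → (Subset m → ℤ) → ℤ
sumSubsets {zero}  f = f []
sumSubsets {suc m} f = sumSubsets (λ s → f (outside ∷ s)) + sumSubsets (λ s → f (inside ∷ s))

signIf : ∀ {m} {P : Subset m → Set} → ((F : Subset m) → Dec (P F)) → Subset m → ℤ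
signIf d F with d F
... | yes _ = (- 1ℤ) ^ ∣ F ∣
... | no  _ = 0ℤ

module Submission where

open import Defs
open import Data.Nat using (ℕ; zero; suc; NonZero)
open import Data.Fin using (Fin; zero; suc; punchIn; punchOut; _≟_)
open import Data.Fin.Properties using (punchIn-punchOut; any?)
open import Data.Fin.Subset using (Subset; _∈_; _∉_; inside; outside; ∣_∣)
open import Data.Vec using ([]; _∷_; insertAt)
open import Data.Vec.Properties using (insertAt-lookup; insertAt-punchIn; []=⇒lookup; lookup⇒[]=)
open import Data.Integer using (ℤ; 0ℤ; 1ℤ; _+_; _-_; -_; _^_)
open import Data.Integer.Properties
  using (+-commutativeSemigroup; neg-distrib-+; -1*i≡-i; +-inverseʳ)
open import Algebra.Properties.CommutativeSemigroup +-commutativeSemigroup using (interchange)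
open import Data.Product using (_×_; _,_; proj₁; proj₂; ∃-syntax)
open import Data.Sum using (_⊎_; inj₁; inj₂; [_,_]) renaming (map to ⊎-map)
open import Function using (_∘_; _⇔_; mk⇔; Equivalence)
open import Function.Properties.Equivalence using () renaming (trans to ⇔-trans)
open import Relation.Nullary using (Dec; yes; no; ¬_; contradiction)
open import Relation.Nullary.Decidable using (_⊎-dec_)
open import Level using (0ℓ)
open import Relation.Unary using (Pred; Decidable; _∪_)
open import Relation.Unary.Properties using (_∪?_)
open import Relation.Binary.PropositionalEquality
  using (_≡_; refl; sym; trans; cong; cong₂; subst; module ≡-Reasoning)

-- Replace the base vertex v by an arbitrary set S of initially infected
-- vertices; the signed count of S-pandemic sets is then 1 for an edgeless
-- graph and 0 otherwise. If no edge touches S, nothing is S-pandemic. Else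
-- pick an edge i with an endpoint in S. The pandemic sets avoiding i are the
-- S-pandemic sets of Γ − i; those containing i are, with i removed, the sets
-- of Γ − i that are pandemic from S together with both endpoints of i (i
-- infects them at once). By induction both families have the same signed
-- count, and adding i flips every sign.

sumSubsets-cong : ∀ {m} {f g : Subset m → ℤ} → (∀ s → f s ≡ g s) → sumSubsets f ≡ sumSubsets g
sumSubsets-cong {zero}  f≡g = f≡g []
sumSubsets-cong {suc m} f≡g =
  cong₂ _+_ (sumSubsets-cong (f≡g ∘ (outside ∷_))) (sumSubsets-cong (f≡g ∘ (inside ∷_)))

sumSubsets-neg : ∀ {m} (f : Subset m → ℤ) → sumSubsets (λ s → - f s) ≡ - sumSubsets f
sumSubsets-neg {zero}  f = refl
sumSubsets-neg {suc m} f = trans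
  (cong₂ _+_ (sumSubsets-neg (f ∘ (outside ∷_))) (sumSubsets-neg (f ∘ (inside ∷_))))
  (sym (neg-distrib-+ (sumSubsets (f ∘ (outside ∷_))) (sumSubsets (f ∘ (inside ∷_)))))

sumSubsets-zero : ∀ {m} (f : Subset m → ℤ) → (∀ s → f s ≡ 0ℤ) → sumSubsets f ≡ 0ℤ
sumSubsets-zero {zero}  f f≡0 = f≡0 []
sumSubsets-zero {suc m} f f≡0 =
  cong₂ _+_ (sumSubsets-zero (f ∘ (outside ∷_)) (f≡0 ∘ (outside ∷_)))
            (sumSubsets-zero (f ∘ (inside ∷_)) (f≡0 ∘ (inside ∷_)))

sumSubsets-insertAt : ∀ {m} (i : Fin (suc m)) (f : Subset (suc m) → ℤ) →
  sumSubsets f ≡ sumSubsets (λ s → f (insertAt s i outside)) + sumSubsets (λ s → f (insertAt s i inside))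
sumSubsets-insertAt zero    f = refl
sumSubsets-insertAt {suc m} (suc i) f = trans
  (cong₂ _+_ (sumSubsets-insertAt i (f ∘ (outside ∷_))) (sumSubsets-insertAt i (f ∘ (inside ∷_))))
  (interchange (sumSubsets (λ s → f (outside ∷ insertAt s i outside)))
               (sumSubsets (λ s → f (outside ∷ insertAt s i inside)))
               (sumSubsets (λ s → f (inside ∷ insertAt s i outside)))
               (sumSubsets (λ s → f (inside ∷ insertAt s i inside))))

∣insertAt-outside∣ : ∀ {m} (s : Subset m) i → ∣ insertAt s i outside ∣ ≡ ∣ s ∣
∣insertAt-outside∣ s             zero    = refl
∣insertAt-outside∣ (outside ∷ s) (suc i) = ∣insertAt-outside∣ s i
∣insertAt-outside∣ (inside ∷ s)  (suc i) = cong suc (∣insertAt-outside∣ s i)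

∣insertAt-inside∣ : ∀ {m} (s : Subset m) i → ∣ insertAt s i inside ∣ ≡ suc ∣ s ∣
∣insertAt-inside∣ s             zero    = refl
∣insertAt-inside∣ (outside ∷ s) (suc i) = ∣insertAt-inside∣ s i
∣insertAt-inside∣ (inside ∷ s)  (suc i) = cong suc (∣insertAt-inside∣ s i)

module _ {k m} {P : Pred (Subset m) 0ℓ} (P? : Decidable P) (h : Subset k → Subset m) where

  signIf-∘ : (∀ s → ∣ h s ∣ ≡ ∣ s ∣) → ∀ s → signIf P? (h s) ≡ signIf (P? ∘ h) s
  signIf-∘ ∣h∣ s with P? (h s)
  ... | yes _ = cong ((- 1ℤ) ^_) (∣h∣ s)
  ... | no  _ = refl

  signIf-∘-suc : (∀ s → ∣ h s ∣ ≡ suc ∣ s ∣) → ∀ s → signIf P? (h s) ≡ - signIf (P? ∘ h) s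
  signIf-∘-suc ∣h∣ s with P? (h s)
  ... | yes _ = trans (cong ((- 1ℤ) ^_) (∣h∣ s)) (-1*i≡-i _)
  ... | no  _ = refl

signIf-insertAt : ∀ {m} {P : Pred (Subset (suc m)) 0ℓ} (P? : Decidable P) (i : Fin (suc m)) →
  sumSubsets (signIf P?) ≡
    sumSubsets (signIf (λ s → P? (insertAt s i outside))) - sumSubsets (signIf (λ s → P? (insertAt s i inside)))
signIf-insertAt P? i = begin
  sumSubsets (signIf P?)
    ≡⟨ sumSubsets-insertAt i (signIf P?) ⟩
  sumSubsets (λ s → signIf P? (insertAt s i outside)) + sumSubsets (λ s → signIf P? (insertAt s i inside))
    ≡⟨ cong₂ _+_ (sumSubsets-cong (signIf-∘ P? (λ s → insertAt s i outside) (λ s → ∣insertAt-outside∣ s i)))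
                 (sumSubsets-cong (signIf-∘-suc P? (λ s → insertAt s i inside) (λ s → ∣insertAt-inside∣ s i))) ⟩
  sumSubsets (signIf (λ s → P? (insertAt s i outside))) + sumSubsets (λ s → - signIf (λ s → P? (insertAt s i inside)) s)
    ≡⟨ cong (sumSubsets (signIf (λ s → P? (insertAt s i outside))) +_)
         (sumSubsets-neg (signIf (λ s → P? (insertAt s i inside)))) ⟩
  sumSubsets (signIf (λ s → P? (insertAt s i outside))) - sumSubsets (signIf (λ s → P? (insertAt s i inside))) ∎
  where open ≡-Reasoning

signIf-never : ∀ {m} {P : Pred (Subset m) 0ℓ} (P? : Decidable P) → (∀ s → ¬ P s) →
  sumSubsets (signIf P?) ≡ 0ℤ
signIf-never P? ¬P = sumSubsets-zero (signIf P?) signIf-no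
  where
  signIf-no : ∀ s → signIf P? s ≡ 0ℤ
  signIf-no s with P? s
  ... | yes p = contradiction p (¬P s)
  ... | no  _ = refl

insertAt-∈ : ∀ {m} (s : Subset m) i → i ∈ insertAt s i inside
insertAt-∈ s i = lookup⇒[]= i _ (insertAt-lookup s i inside)

insertAt-∉ : ∀ {m} (s : Subset m) i → i ∉ insertAt s i outside
insertAt-∉ s i i∈ with trans (sym (insertAt-lookup s i outside)) ([]=⇒lookup i∈)
... | ()

∈-insertAt⁺ : ∀ {m} (s : Subset m) i b {j} → j ∈ s → punchIn i j ∈ insertAt s i b
∈-insertAt⁺ s i b {j} j∈s = lookup⇒[]= (punchIn i j) _ (trans (insertAt-punchIn s i b j) ([]=⇒lookup j∈s))

∈-insertAt⁻ : ∀ {m} (s : Subset m) i b {j} → punchIn i j ∈ insertAt s i b → j ∈ s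
∈-insertAt⁻ s i b {j} j∈ = lookup⇒[]= j s (trans (sym (insertAt-punchIn s i b j)) ([]=⇒lookup j∈))

data PunchInView {m} (i : Fin (suc m)) : Fin (suc m) → Set where
  at      : PunchInView i i
  punched : ∀ j → PunchInView i (punchIn i j)

punchInView : ∀ {m} (i e : Fin (suc m)) → PunchInView i e
punchInView i e with i ≟ e
... | yes refl = at
... | no  i≢e  = subst (PunchInView i) (punchIn-punchOut i≢e) (punched (punchOut i≢e))

mkGraph : (n m : ℕ) → (Fin m → Fin n × Fin n) → Multigraph
mkGraph n m es = record { nV = n ; nE = m ; ends = es }

Reachable : (Γ : Multigraph) → Pred (Fin (nV Γ)) 0ℓ → Subset (nE Γ) → Pred (Fin (nV Γ)) 0ℓ
Reachable Γ S F y = ∃[ x ] S x × FPath Γ F x y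

PandemicFrom : (Γ : Multigraph) → Pred (Fin (nV Γ)) 0ℓ → Subset (nE Γ) → Set
PandemicFrom Γ S F = ∀ e → Reachable Γ S F (proj₁ (ends Γ e)) ⊎ Reachable Γ S F (proj₂ (ends Γ e))

Endpoint : (Γ : Multigraph) → Fin (nE Γ) → Pred (Fin (nV Γ)) 0ℓ
Endpoint Γ e y = y ≡ proj₁ (ends Γ e) ⊎ y ≡ proj₂ (ends Γ e)

endpoint? : ∀ Γ e → Decidable (Endpoint Γ e)
endpoint? Γ e y = (y ≟ proj₁ (ends Γ e)) ⊎-dec (y ≟ proj₂ (ends Γ e))

Joins⇒endpointˡ : ∀ {Γ e y z} → Joins Γ e y z → Endpoint Γ e y
Joins⇒endpointˡ (inj₁ e≡yz) = inj₁ (sym (cong proj₁ e≡yz))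
Joins⇒endpointˡ (inj₂ e≡zy) = inj₂ (sym (cong proj₂ e≡zy))

Joins⇒endpointʳ : ∀ {Γ e y z} → Joins Γ e y z → Endpoint Γ e z
Joins⇒endpointʳ (inj₁ e≡yz) = inj₂ (sym (cong proj₂ e≡yz))
Joins⇒endpointʳ (inj₂ e≡zy) = inj₁ (sym (cong proj₁ e≡zy))

Touches : (Γ : Multigraph) → Pred (Fin (nV Γ)) 0ℓ → Set
Touches Γ S = ∃[ e ] (S (proj₁ (ends Γ e)) ⊎ S (proj₂ (ends Γ e)))

touches? : ∀ Γ {S} → Decidable S → Dec (Touches Γ S)
touches? Γ S? = any? (λ e → S? (proj₁ (ends Γ e)) ⊎-dec S? (proj₂ (ends Γ e)))

FPath-++ : ∀ {Γ F x y z} → FPath Γ F x y → FPath Γ F y z → FPath Γ F x z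
FPath-++ p here               = p
FPath-++ p (step e q e∈F e~) = step e (FPath-++ p q) e∈F e~

endpoint⇒touches : ∀ {Γ S e y} → S y → Endpoint Γ e y → Touches Γ S
endpoint⇒touches {e = e} Sy (inj₁ refl) = e , inj₁ Sy
endpoint⇒touches {e = e} Sy (inj₂ refl) = e , inj₂ Sy

FPath-stays-or-touches : ∀ {Γ S F x y} → FPath Γ F x y → S x → S y ⊎ Touches Γ S
FPath-stays-or-touches here Sx = inj₁ Sx
FPath-stays-or-touches {Γ} {S} (step e p _ e~) Sx with FPath-stays-or-touches {S = S} p Sx
... | inj₁ Sy    = inj₂ (endpoint⇒touches {Γ} {S} Sy (Joins⇒endpointˡ {Γ} e~))
... | inj₂ touch = inj₂ touch

reachable⇒touches : ∀ {Γ S F e y} → Reachable Γ S F y → Endpoint Γ e y → Touches Γ S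
reachable⇒touches {Γ} {S} (x , Sx , p) y-end with FPath-stays-or-touches {S = S} p Sx
... | inj₁ Sy    = endpoint⇒touches {Γ} {S} Sy y-end
... | inj₂ touch = touch

pandemicFrom⇒touches : ∀ {Γ S F} → PandemicFrom Γ S F → Fin (nE Γ) → Touches Γ S
pandemicFrom⇒touches pandemic e =
  [ (λ r → reachable⇒touches r (inj₁ refl)) , (λ r → reachable⇒touches r (inj₂ refl)) ] (pandemic e)

module EdgeRemoval {n m} (es : Fin (suc m) → Fin n × Fin n) (i : Fin (suc m)) where

  Γ : Multigraph
  Γ = mkGraph n (suc m) es

  Γ∖i : Multigraph
  Γ∖i = mkGraph n m (es ∘ punchIn i)

  a b : Fin n
  a = proj₁ (es i)
  b = proj₂ (es i)

  FPath-insertAt⁺ : ∀ {s c x y} → FPath Γ∖i s x y → FPath Γ (insertAt s i c) x y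
  FPath-insertAt⁺ here = here
  FPath-insertAt⁺ {s} {c} (step j p j∈s j~) =
    step (punchIn i j) (FPath-insertAt⁺ p) (∈-insertAt⁺ s i c j∈s) j~

  FPath-insertAt-outside⁻ : ∀ {s x y} → FPath Γ (insertAt s i outside) x y → FPath Γ∖i s x y
  FPath-insertAt-outside⁻ here = here
  FPath-insertAt-outside⁻ {s} (step e p e∈ e~) with punchInView i e
  ... | at        = contradiction e∈ (insertAt-∉ s i)
  ... | punched j = step j (FPath-insertAt-outside⁻ p) (∈-insertAt⁻ s i outside e∈) e~

  endpoint-reachable : ∀ {S s y} → S a ⊎ S b → Endpoint Γ i y → Reachable Γ S (insertAt s i inside) y
  endpoint-reachable         (inj₁ Sa) (inj₁ refl) = a , Sa , here
  endpoint-reachable {s = s} (inj₁ Sa) (inj₂ refl) = a , Sa , step i here (insertAt-∈ s i) (inj₁ refl)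
  endpoint-reachable {s = s} (inj₂ Sb) (inj₁ refl) = b , Sb , step i here (insertAt-∈ s i) (inj₂ refl)
  endpoint-reachable         (inj₂ Sb) (inj₂ refl) = b , Sb , here

  FPath-insertAt-inside⁻ : ∀ {S s x y} → FPath Γ (insertAt s i inside) x y → S x →
    Reachable Γ∖i (S ∪ Endpoint Γ i) s y
  FPath-insertAt-inside⁻ here Sx = _ , inj₁ Sx , here
  FPath-insertAt-inside⁻ {s = s} (step e p e∈ e~) Sx with punchInView i e
  ... | at = _ , inj₂ (Joins⇒endpointʳ {Γ} e~) , here
  ... | punched j with FPath-insertAt-inside⁻ p Sx
  ...   | x , S⁺x , q = x , S⁺x , step j q (∈-insertAt⁻ s i inside e∈) e~

  pandemicFrom-outside : ∀ {S} → S a ⊎ S b → ∀ s →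
    PandemicFrom Γ S (insertAt s i outside) ⇔ PandemicFrom Γ∖i S s
  pandemicFrom-outside {S} i-touches s = mk⇔
    (λ pandemic j → ⊎-map reach⁻ reach⁻ (pandemic (punchIn i j)))
    (λ pandemic e → from pandemic e (punchInView i e))
    where
    reach⁻ : ∀ {y} → Reachable Γ S (insertAt s i outside) y → Reachable Γ∖i S s y
    reach⁻ (x , Sx , p) = x , Sx , FPath-insertAt-outside⁻ p
    reach⁺ : ∀ {y} → Reachable Γ∖i S s y → Reachable Γ S (insertAt s i outside) y
    reach⁺ (x , Sx , p) = x , Sx , FPath-insertAt⁺ p
    from : PandemicFrom Γ∖i S s → ∀ e → PunchInView i e →
      Reachable Γ S (insertAt s i outside) (proj₁ (es e)) ⊎ Reachable Γ S (insertAt s i outside) (proj₂ (es e))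
    from pandemic _ at          = ⊎-map (λ Sa → a , Sa , here) (λ Sb → b , Sb , here) i-touches
    from pandemic _ (punched j) = ⊎-map reach⁺ reach⁺ (pandemic j)

  pandemicFrom-inside : ∀ {S} → S a ⊎ S b → ∀ s →
    PandemicFrom Γ S (insertAt s i inside) ⇔ PandemicFrom Γ∖i (S ∪ Endpoint Γ i) s
  pandemicFrom-inside {S} i-touches s = mk⇔
    (λ pandemic j → ⊎-map reach⁻ reach⁻ (pandemic (punchIn i j)))
    (λ pandemic e → from pandemic e (punchInView i e))
    where
    reach⁻ : ∀ {y} → Reachable Γ S (insertAt s i inside) y → Reachable Γ∖i (S ∪ Endpoint Γ i) s y
    reach⁻ (x , Sx , p) = FPath-insertAt-inside⁻ p Sx
    reach⁺ : ∀ {y} → Reachable Γ∖i (S ∪ Endpoint Γ i) s y → Reachable Γ S (insertAt s i inside) y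
    reach⁺ (x , inj₁ Sx , q) = x , Sx , FPath-insertAt⁺ q
    reach⁺ (x , inj₂ x-end , q) with endpoint-reachable i-touches x-end
    ... | x′ , Sx′ , r = x′ , Sx′ , FPath-++ r (FPath-insertAt⁺ q)
    from : PandemicFrom Γ∖i (S ∪ Endpoint Γ i) s → ∀ e → PunchInView i e →
      Reachable Γ S (insertAt s i inside) (proj₁ (es e)) ⊎ Reachable Γ S (insertAt s i inside) (proj₂ (es e))
    from pandemic _ at          = inj₁ (endpoint-reachable i-touches (inj₁ refl))
    from pandemic _ (punched j) = ⊎-map reach⁺ reach⁺ (pandemic j)

δ₀ : ℕ → ℤ
δ₀ zero    = 1ℤ
δ₀ (suc _) = 0ℤ

δ₀-nonZero : ∀ {m} → NonZero m → δ₀ m ≡ 0ℤ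
δ₀-nonZero {suc m} _ = refl

signIf-pandemicFrom : ∀ n m (es : Fin m → Fin n × Fin n) {S : Pred (Fin n) 0ℓ} → Decidable S →
  {P : Pred (Subset m) 0ℓ} (P? : Decidable P) → (∀ F → P F ⇔ PandemicFrom (mkGraph n m es) S F) →
  sumSubsets (signIf P?) ≡ δ₀ m
signIf-pandemicFrom n zero es S? P? P⇔ with P? []
... | yes _  = refl
... | no ¬P  = contradiction (Equivalence.from (P⇔ []) (λ ())) ¬P
signIf-pandemicFrom n (suc m) es S? P? P⇔ with touches? (mkGraph n (suc m) es) S?
... | no ¬touches = signIf-never P? λ F PF →
  ¬touches (pandemicFrom⇒touches (Equivalence.to (P⇔ F) PF) zero)
... | yes (i , i-touches) = begin
  sumSubsets (signIf P?)
    ≡⟨ signIf-insertAt P? i ⟩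
  sumSubsets (signIf (λ s → P? (insertAt s i outside))) - sumSubsets (signIf (λ s → P? (insertAt s i inside)))
    ≡⟨ cong₂ _-_ deleted contracted ⟩
  δ₀ m - δ₀ m
    ≡⟨ +-inverseʳ (δ₀ m) ⟩
  0ℤ ∎
  where
  open ≡-Reasoning
  open EdgeRemoval es i
  deleted : sumSubsets (signIf (λ s → P? (insertAt s i outside))) ≡ δ₀ m
  deleted = signIf-pandemicFrom n m (es ∘ punchIn i) S? (λ s → P? (insertAt s i outside))
    (λ s → ⇔-trans (P⇔ (insertAt s i outside)) (pandemicFrom-outside i-touches s))
  contracted : sumSubsets (signIf (λ s → P? (insertAt s i inside))) ≡ δ₀ m
  contracted = signIf-pandemicFrom n m (es ∘ punchIn i) (S? ∪? endpoint? Γ i) (λ s → P? (insertAt s i inside))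
    (λ s → ⇔-trans (P⇔ (insertAt s i inside)) (pandemicFrom-inside i-touches s))

pandemic⇔pandemicFrom : ∀ Γ v F → Pandemic Γ v F ⇔ PandemicFrom Γ (v ≡_) F
pandemic⇔pandemicFrom Γ v F = mk⇔
  (λ pandemic e → ⊎-map (λ p → v , refl , p) (λ p → v , refl , p) (pandemic e))
  (λ pandemic e → ⊎-map path path (pandemic e))
  where
  path : ∀ {y} → Reachable Γ (v ≡_) F y → FPath Γ F v y
  path (_ , refl , p) = p

theorem1p2 : (Γ : Multigraph) (v : Fin (nV Γ)) → NonZero (nE Γ) →
    (dec : (F : Subset (nE Γ)) → Dec (Pandemic Γ v F)) →
    sumSubsets (signIf dec) ≡ 0ℤ
theorem1p2 Γ v nonZero dec = trans
  (signIf-pandemicFrom (nV Γ) (nE Γ) (ends Γ) (v ≟_) dec (pandemic⇔pandemicFrom Γ v))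
  (δ₀-nonZero nonZero)
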